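{- Let $T$ be a diagram with labeling $\mathcal{L}$. For every column index $c$, $\mathcal{L}$ is flagged if and only if the rectified labeling $\mathfrak{R}_c^*(\mathcal{L})$ of $\mathfrak{R}_c^*(T)$ is flagged.
   Context: A diagram is a finite set of cells $(c,r)$, $c,r$ positive integers ($c$ column, $r$ row, rows numbered from the bottom). A labeling $\mathcal{L}$ of $T$ assigns a positive integer to each cell; it is flagged if $\mathcal{L}(x)\ge r$ for every cell $x$ of $T$ in row $r$. Column $c$-pairing: first pair cells of columns $c,c+1$ in the same row, then iteratively pair an unpaired cell in column $c+1$ with an unpaired cell in column $c$ above it whenever all cells of columns $c,c+1$ in rows strictly between are already paired. $\mathfrak{R}_c(T)=T$ if column $c+1$ has no unpaired cell, else it moves the lowest unpaired cell of column $c+1$ left to column $c$ (same row); $\mathfrak{R}_c^*(T)$ iterates $\mathfrak{R}_c$ until fixed. Label $c$-pairing w.r.t. $\mathcal{L}$: processing cells $x$ of column $c+1$ from top to bottom, pair $x$ with the not yet paired cell $y$ of column $c$ lying weakly above $x$ whose label is the largest label $\le\mathcal{L}(x)$ among such cells; if none, $x$ is unpaired. Relabeling $\mathfrak{R}_c^*(\mathcal{L})$: let $x_1,\dots,x_m$ be the cells of column $c+1$ not label $c$-paired, from highest to lowest; set $\mathcal{L}'=\mathcal{L}$; for $i=1,\dots,m$, if there is a cell $z$ of column $c+1$ above $x_i$ that is label $c$-paired with a cell $y$ with $\mathcal{L}(y)\le\mathcal{L}'(x_i)<\mathcal{L}'(z)$, choose such $z$ with $\mathcal{L}'(z)$ maximal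 and swap the labels of $x_i$ and $z$; then for every cell $z$ of column $c+1$ label $c$-paired with a cell $y$, set $\mathcal{L}'(z)=\mathcal{L}(y)$. $\mathfrak{R}_c^*(\mathcal{L})$ is the labeling of $\mathfrak{R}_c^*(T)$ obtained by keeping the $\mathcal{L}'$-labels on cells as they move left. -}

module Defs where

open import Data.Nat using (ℕ; zero; suc; _≤_; _≡ᵇ_; _≤ᵇ_; _<ᵇ_; _⊔_)
open import Data.Bool using (Bool; true; false; _∧_; _∨_; not; if_then_else_)
open import Data.Product using (_×_; _,_; proj₁; proj₂)
open import Data.List using (List; []; _∷_; map; length; foldr; foldl; reverse; filterᵇ)
open import Data.Bool.ListAction using (any)
open import Data.Maybe using (Maybe; nothing; just)
open import Data.List.Relation.Unary.All using (All)

-- A cell (c , r): column c, row r (rows numbered from the bottom).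
Cell : Set
Cell = ℕ × ℕ

col : Cell → ℕ
col = proj₁

row : Cell → ℕ
row = proj₂

-- A diagram is represented by a duplicate-free list of cells
-- (duplicate-freeness and positivity are hypotheses of the theorem).
Diagram : Set
Diagram = List Cell

-- A labeling of T is a function on cells (only its values on T matter).
Labeling : Set
Labeling = Cell → ℕ

LCell : Set
LCell = Cell × ℕ

Flagged : Diagram → Labeling → Set
Flagged T L = All (λ x → row x ≤ L x) T

FlaggedL : List LCell → Set
FlaggedL = All (λ p → row (proj₁ p) ≤ proj₂ p)

cellEq : Cell → Cell → Bool
cellEq (a , b) (c , d) = (a ≡ᵇ c) ∧ (b ≡ᵇ d)

member : Cell → Diagram → Bool
member x T = any (cellEq x) T

maxRow : Diagram → ℕ
maxRow = foldr (λ x m → row x ⊔ m) 0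

rowsDesc : ℕ → List ℕ
rowsDesc zero = []
rowsDesc (suc n) = suc n ∷ rowsDesc n

rowsAsc : ℕ → List ℕ
rowsAsc n = reverse (rowsDesc n)

dropTop : List ℕ → List ℕ
dropTop [] = []
dropTop (_ ∷ xs) = xs

minList : List ℕ → Maybe ℕ
minList [] = nothing
minList (x ∷ xs) with minList xs
... | nothing = just x
... | just m = just (if x ≤ᵇ m then x else m)

-- After pairing same-row cells of columns c, c+1, the iterative pairing of
-- an unpaired cell of column c+1 with an unpaired cell of column c above it
-- (all cells strictly between already paired) is bracket matching: scanning
-- rows bottom to top, an unpaired cell of column c+1 is pushed on a stack and
-- an unpaired cell of column c pairs with the top of the stack.
-- `scan` returns the rows of the unpaired cells of column c+1.

scan : ℕ → Diagram → List ℕ → List ℕ → List ℕ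
scan c T [] st = st
scan c T (r ∷ rs) st with member (c , r) T | member (suc c , r) T
... | true  | true  = scan c T rs st
... | false | true  = scan c T rs (r ∷ st)
... | true  | false = scan c T rs (dropTop st)
... | false | false = scan c T rs st

unpairedRows : ℕ → Diagram → List ℕ
unpairedRows c T = scan c T (rowsAsc (maxRow T)) []

moveCell : ℕ → ℕ → LCell → LCell
moveCell c r ((a , b) , l) =
  if (a ≡ᵇ suc c) ∧ (b ≡ᵇ r) then ((c , b) , l) else ((a , b) , l)

Rstep : ℕ → List LCell → List LCell
Rstep c LT with minList (unpairedRows c (map proj₁ LT))
... | nothing = LT
... | just r  = map (moveCell c r) LT

Riter : ℕ → ℕ → List LCell → List LCell
Riter zero    c LT = LT
Riter (suc n) c LT = Riter n c (Rstep c LT)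

-- ℜ_c^*: iterate ℜ_c until fixed. Each non-trivial step removes a cell from
-- column c+1, so (length LT) iterations reach the fixed point.
Rstar : ℕ → List LCell → List LCell
Rstar c LT = Riter (length LT) c LT

RstarT : ℕ → Diagram → Diagram
RstarT c T = map proj₁ (Rstar c (map (λ x → x , 0) T))

colCells : ℕ → Diagram → Labeling → List (ℕ × ℕ)
colCells c T L = foldr (λ x acc → if col x ≡ᵇ c then (row x , L x) ∷ acc else acc) [] T

-- among available cells y with row y ≥ r and label ≤ l, one with largest label
-- (ties: the first one found; the outcome of the relabeling does not depend on it)
chooseY : ℕ → ℕ → List (ℕ × ℕ) → Maybe (ℕ × ℕ)
chooseY r l = foldl step nothing
  where
  ok : ℕ × ℕ → Bool
  ok (ry , ly) = (r ≤ᵇ ry) ∧ (ly ≤ᵇ l)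
  step : Maybe (ℕ × ℕ) → ℕ × ℕ → Maybe (ℕ × ℕ)
  step nothing y = if ok y then just y else nothing
  step (just b) y = if ok y ∧ (proj₂ b <ᵇ proj₂ y) then just y else just b

removeRow : ℕ → List (ℕ × ℕ) → List (ℕ × ℕ)
removeRow r = filterᵇ (λ y → not (proj₁ y ≡ᵇ r))

-- Process cells of column c+1 (given by their rows, top to bottom).
-- Returns (paired cells as (row of x , L(y)) , unpaired rows), both top to bottom.
labelPair : (ℕ → ℕ) → List ℕ → List (ℕ × ℕ) → List (ℕ × ℕ) × List ℕ
labelPair Lx [] avail = [] , []
labelPair Lx (r ∷ rs) avail with chooseY r (Lx r) avail
... | nothing = let res = labelPair Lx rs avail in proj₁ res , (r ∷ proj₂ res)
... | just (ry , ly) =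
  let res = labelPair Lx rs (removeRow ry avail) in ((r , ly) ∷ proj₁ res) , proj₂ res

colRowsDesc : ℕ → Diagram → List ℕ
colRowsDesc c T = filterᵇ (λ r → member (c , r) T) (rowsDesc (maxRow T))

update : (ℕ → ℕ) → ℕ → ℕ → (ℕ → ℕ)
update f r v r' = if r' ≡ᵇ r then v else f r'

-- for unpaired x_i at row ri: among paired z (row rz, partner label ly) above x_i
-- with ly ≤ f ri < f rz choose one with f rz maximal (ties: highest such z)
chooseZ : (ℕ → ℕ) → ℕ → List (ℕ × ℕ) → Maybe ℕ
chooseZ f ri = foldl step nothing
  where
  ok : ℕ × ℕ → Bool
  ok (rz , ly) = (ri <ᵇ rz) ∧ (ly ≤ᵇ f ri) ∧ (f ri <ᵇ f rz)
  step : Maybe ℕ → ℕ × ℕ → Maybe ℕ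
  step nothing z = if ok z then just (proj₁ z) else nothing
  step (just b) z = if ok z ∧ (f b <ᵇ f (proj₁ z)) then just (proj₁ z) else just b

swapLoop : List (ℕ × ℕ) → List ℕ → (ℕ → ℕ) → (ℕ → ℕ)
swapLoop paired [] f = f
swapLoop paired (ri ∷ xs) f with chooseZ f ri paired
... | nothing = swapLoop paired xs f
... | just rz = swapLoop paired xs (update (update f ri (f rz)) rz (f ri))

lookupPaired : List (ℕ × ℕ) → ℕ → Maybe ℕ
lookupPaired [] r = nothing
lookupPaired ((rz , ly) ∷ ps) r = if rz ≡ᵇ r then just ly else lookupPaired ps r

finalLabel : List (ℕ × ℕ) → (ℕ → ℕ) → ℕ → ℕ
finalLabel paired f r with lookupPaired paired r
... | just ly = ly
... | nothing = f r

newLabels : ℕ → Diagram → Labeling → (ℕ → ℕ)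
newLabels c T L = finalLabel (proj₁ res) (swapLoop (proj₁ res) (proj₂ res) Lx)
  where
  Lx : ℕ → ℕ
  Lx r' = L (suc c , r')
  res : List (ℕ × ℕ) × List ℕ
  res = labelPair Lx (colRowsDesc (suc c) T) (colCells c T L)

relabel : ℕ → Diagram → Labeling → List LCell
relabel c T L =
  map (λ x → x , (if col x ≡ᵇ suc c then newLabels c T L (row x) else L x)) T

RstarL : ℕ → Diagram → Labeling → List LCell
RstarL c T L = Rstar c (relabel c T L)

module Submission where

-- Flaggedness is a condition on each (cell , label) pair separately, and
-- ℜ_c^* only moves cells horizontally, each cell keeping its row and its
-- label; so ℜ_c^* neither creates nor destroys flaggedness.  Hence the
-- content of the theorem is that the relabeling L ↦ L' preserves and
-- reflects flaggedness.  Labels outside column c+1 are untouched, and, once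
-- column c is flagged, every cell x of column c+1 in row r satisfies
--   r ≤ L'(x)  ⇔  r ≤ L(x):
--  * if x is label c-paired with y, then L'(x) = L(y), where y lies weakly
--    above x and L(y) ≤ L(x); so r ≤ row y ≤ L(y) ≤ L(x) and both sides hold;
--  * an unpaired x only ever swaps labels with a paired z above it such that
--    L(y) ≤ L'(x) < L'(z); then r < row z ≤ L(y) ≤ L'(x), so x is flagged
--    both before and after the swap.
-- Column c is flagged under either side of the equivalence, so the theorem
-- follows.

open import Defs
open import Data.Nat using (ℕ; zero; suc; _≤_; _<_; _≡ᵇ_; _≤ᵇ_; _<ᵇ_)
open import Data.Nat.Properties using (≤-trans; <⇒≤; ≡ᵇ⇒≡; ≡⇒≡ᵇ; ≤ᵇ⇒≤; <ᵇ⇒<; 1+n≢n)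
open import Data.Bool using (Bool; true; false; T; _∧_; if_then_else_)
open import Data.Bool.Properties using (T-∧; T-≡)
open import Data.Product using (_×_; _,_; proj₁; proj₂)
open import Data.Sum using (_⊎_; inj₁; inj₂) renaming (map₂ to ⊎-map₂)
open import Data.Maybe using (Maybe; nothing; just)
open import Data.Empty using (⊥-elim)
open import Data.Unit using (tt)
open import Data.List using (List; []; _∷_; map; foldl; length)
open import Data.List.Membership.Propositional using (_∈_)
open import Data.List.Relation.Unary.Any using (Any; here; there)
  renaming (map to Any-map; lookup to Any-lookup)
open import Data.List.Relation.Unary.All using (All; []; _∷_; lookupAny)
  renaming (map to All-map; lookup to All-lookup)
open import Data.List.Relation.Unary.All.Properties using (map⁺; map⁻; filter⁺)
open import Data.List.Relation.Unary.Unique.Propositional using (Unique)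
open import Function using (_∘_)
open import Function.Bundles using (_⇔_; mk⇔; Equivalence)
open import Function.Construct.Identity using (⇔-id)
open import Function.Construct.Composition using (_⇔-∘_)
open import Function.Construct.Symmetry using (⇔-sym)
open import Relation.Binary.PropositionalEquality using (_≡_; _≢_; refl; sym; subst)

open Equivalence using (to; from)

FlaggedCell : LCell → Set
FlaggedCell p = row (proj₁ p) ≤ proj₂ p

All-map-⇔ : {A B : Set} {P : B → Set} {Q : A → Set} (f : A → B) →
            (∀ x → P (f x) ⇔ Q x) → ∀ xs → All P (map f xs) ⇔ All Q xs
All-map-⇔ f pq xs =
  mk⇔ (All-map (λ {x} → to (pq x)) ∘ map⁻) (map⁺ ∘ All-map (λ {x} → from (pq x)))

moveCell-flagged : ∀ c r p → FlaggedCell (moveCell c r p) ⇔ FlaggedCell p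
moveCell-flagged c r ((a , b) , l) with (a ≡ᵇ suc c) ∧ (b ≡ᵇ r)
... | true  = ⇔-id _
... | false = ⇔-id _

Rstep-flagged : ∀ c LT → FlaggedL (Rstep c LT) ⇔ FlaggedL LT
Rstep-flagged c LT with minList (unpairedRows c (map proj₁ LT))
... | nothing = ⇔-id _
... | just r  = All-map-⇔ (moveCell c r) (moveCell-flagged c r) LT

Riter-flagged : ∀ n c LT → FlaggedL (Riter n c LT) ⇔ FlaggedL LT
Riter-flagged zero    c LT = ⇔-id _
Riter-flagged (suc n) c LT = Rstep-flagged c LT ⇔-∘ Riter-flagged n c (Rstep c LT)

Rstar-flagged : ∀ c LT → FlaggedL (Rstar c LT) ⇔ FlaggedL LT
Rstar-flagged c LT = Riter-flagged (length LT) c LT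

Selective : {A B : Set} → (A → B → Set) → (Maybe B → A → Maybe B) → Set
Selective Q step = ∀ acc y {b} → step acc y ≡ just b → acc ≡ just b ⊎ Q y b

selective-foldl : {A B : Set} {Q : A → B → Set} {step : Maybe B → A → Maybe B} →
                  Selective Q step → ∀ xs acc {b} → foldl step acc xs ≡ just b →
                  acc ≡ just b ⊎ Any (λ y → Q y b) xs
selective-foldl sel [] acc e = inj₁ e
selective-foldl {step = step} sel (y ∷ xs) acc e with selective-foldl sel xs (step acc y) e
... | inj₂ found = inj₂ (there found)
... | inj₁ e′ with sel acc y e′
...   | inj₁ kept = inj₁ kept
...   | inj₂ q    = inj₂ (here q)

selection : {A B : Set} {Q : A → B → Set} {step : Maybe B → A → Maybe B} →
            Selective Q step → ∀ xs {b} → foldl step nothing xs ≡ just b →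
            Any (λ y → Q y b) xs
selection sel xs e with selective-foldl sel xs nothing e
... | inj₂ found = found

if-just : {B : Set} (b : Bool) {x : B} {m : Maybe B} {v : B} →
          (if b then just x else m) ≡ just v → m ≡ just v ⊎ (T b × x ≡ v)
if-just true  refl = inj₂ (tt , refl)
if-just false e    = inj₁ e

FlaggedPair : ℕ × ℕ → Set
FlaggedPair (r , l) = r ≤ l

-- A label c-pair (r , l): the column-(c+1) cell in row r receives the label l
-- of its partner; l is at least r and at most the old label Lx r.
SoundPair : (ℕ → ℕ) → ℕ × ℕ → Set
SoundPair Lx (r , l) = r ≤ l × l ≤ Lx r

colCells-all : {Q : ℕ × ℕ → Set} → ∀ c T L →
               All (λ x → col x ≡ c → Q (row x , L x)) T → All Q (colCells c T L)
colCells-all c [] L [] = []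
colCells-all c (x ∷ T) L (h ∷ hs) with col x ≡ᵇ c in e
... | true  = h (≡ᵇ⇒≡ (col x) c (from T-≡ e)) ∷ colCells-all c T L hs
... | false = colCells-all c T L hs

chooseY-sound : ∀ r l avail {b} → All FlaggedPair avail → chooseY r l avail ≡ just b →
                FlaggedPair b × r ≤ proj₁ b × proj₂ b ≤ l
chooseY-sound r l avail {b} flagged e =
  subst FlaggedPair (proj₁ (proj₂ facts)) (proj₁ facts) , proj₂ (proj₂ facts)
  where
  Chosen : ℕ × ℕ → ℕ × ℕ → Set
  Chosen y b = y ≡ b × r ≤ proj₁ b × proj₂ b ≤ l
  qualifies : ∀ y {b} → T ((r ≤ᵇ proj₁ y) ∧ (proj₂ y ≤ᵇ l)) × y ≡ b → Chosen y b
  qualifies (ry , ly) (t , refl) = refl , ≤ᵇ⇒≤ r ry (proj₁ (to T-∧ t)) , ≤ᵇ⇒≤ ly l (proj₂ (to T-∧ t))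
  found : Any (λ y → Chosen y b) avail
  found = selection
    (λ { nothing  (ry , ly) e → ⊎-map₂ (qualifies (ry , ly)) (if-just _ e)
       ; (just _) (ry , ly) e →
           ⊎-map₂ (λ { (t , e′) → qualifies (ry , ly) (proj₁ (to T-∧ t) , e′) }) (if-just _ e) })
    avail e
  facts : FlaggedPair (Any-lookup found) × Chosen (Any-lookup found) b
  facts = lookupAny flagged found

labelPair-sound : ∀ Lx rs avail → All FlaggedPair avail →
                  All (SoundPair Lx) (proj₁ (labelPair Lx rs avail))
labelPair-sound Lx [] avail flagged = []
labelPair-sound Lx (r ∷ rs) avail flagged with chooseY r (Lx r) avail in e
... | nothing = labelPair-sound Lx rs avail flagged
... | just (ry , ly) with chooseY-sound r (Lx r) avail flagged e
...   | ry≤ly , r≤ry , ly≤Lx =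
  (≤-trans r≤ry ry≤ly , ly≤Lx) ∷ labelPair-sound Lx rs (removeRow ry avail) (filter⁺ _ flagged)

Paired : List (ℕ × ℕ) → ℕ → Set
Paired ps r = Any (λ p → proj₁ p ≡ r) ps

lookupPaired-sound : ∀ ps {r l} → lookupPaired ps r ≡ just l → (r , l) ∈ ps
lookupPaired-sound ((rz , l′) ∷ ps) {r} e with rz ≡ᵇ r in eq
... | false = there (lookupPaired-sound ps e)
... | true with ≡ᵇ⇒≡ rz r (from T-≡ eq) | e
...   | refl | refl = here refl

lookupPaired-complete : ∀ ps {r} → Paired ps r → lookupPaired ps r ≢ nothing
lookupPaired-complete ((rz , l) ∷ ps) {r} paired e with rz ≡ᵇ r in eq
lookupPaired-complete ((rz , l) ∷ ps) paired () | true
lookupPaired-complete ((rz , l) ∷ ps) (here refl) e | false = subst T eq (≡⇒≡ᵇ rz rz refl)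
lookupPaired-complete ((rz , l) ∷ ps) (there paired) e | false = lookupPaired-complete ps paired e

-- The swap partner chosen for row ri is a paired row rz with ri ≤ f ri < f rz
-- (ri lies below rz, whose partner label is at least rz and at most f ri).
chooseZ-sound : ∀ Lx ps f ri {rz} → All (SoundPair Lx) ps → chooseZ f ri ps ≡ just rz →
                Paired ps rz × ri ≤ f ri × f ri < f rz
chooseZ-sound Lx ps f ri {rz} sound e = paired , ri≤fri , fri<frz
  where
  Chosen : ℕ × ℕ → ℕ → Set
  Chosen z b = proj₁ z ≡ b × ri < proj₁ z × proj₂ z ≤ f ri × f ri < f b
  qualifies : ∀ z {b} → T ((ri <ᵇ proj₁ z) ∧ (proj₂ z ≤ᵇ f ri) ∧ (f ri <ᵇ f (proj₁ z))) ×
              proj₁ z ≡ b → Chosen z b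
  qualifies (rz , ly) (t , refl) with to T-∧ t
  ... | t₁ , t₂₃ with to T-∧ t₂₃
  ...   | t₂ , t₃ = refl , <ᵇ⇒< ri rz t₁ , ≤ᵇ⇒≤ ly (f ri) t₂ , <ᵇ⇒< (f ri) (f rz) t₃
  found : Any (λ z → Chosen z rz) ps
  found = selection
    (λ { nothing  (z , ly) e → ⊎-map₂ (qualifies (z , ly)) (if-just _ e)
       ; (just _) (z , ly) e →
           ⊎-map₂ (λ { (t , e′) → qualifies (z , ly) (proj₁ (to T-∧ t) , e′) }) (if-just _ e) })
    ps e
  facts : SoundPair Lx (Any-lookup found) × Chosen (Any-lookup found) rz
  facts = lookupAny sound found
  paired : Paired ps rz
  paired = Any-map proj₁ found
  ri≤fri : ri ≤ f ri
  ri≤fri with facts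
  ... | (rz≤ly , _) , (_ , ri<rz , ly≤fri , _) = ≤-trans (<⇒≤ ri<rz) (≤-trans rz≤ly ly≤fri)
  fri<frz : f ri < f rz
  fri<frz with facts
  ... | _ , (_ , _ , _ , fri<frz) = fri<frz

-- Invariant of the swap loop: on rows that are not label c-paired, the
-- current labels f are flagged exactly where the original labels Lx are.
Agrees : List (ℕ × ℕ) → (ℕ → ℕ) → (ℕ → ℕ) → Set
Agrees ps Lx f = ∀ r → lookupPaired ps r ≡ nothing → (r ≤ f r ⇔ r ≤ Lx r)

-- A single swap between a row ri and a paired row rz with ri ≤ f ri < f rz
-- keeps the invariant: ri is flagged both before and after, rz is paired.
swap-agrees : ∀ {ps Lx f ri rz} → Agrees ps Lx f → Paired ps rz → ri ≤ f ri → f ri < f rz →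
              Agrees ps Lx (update (update f ri (f rz)) rz (f ri))
swap-agrees {ps} {rz = rz} agree paired ri≤fri fri<frz r unpaired with r ≡ᵇ rz in e₁
... | true with ≡ᵇ⇒≡ r rz (from T-≡ e₁)
...   | refl = ⊥-elim (lookupPaired-complete ps paired unpaired)
swap-agrees {ri = ri} agree paired ri≤fri fri<frz r unpaired | false with r ≡ᵇ ri in e₂
... | false = agree r unpaired
... | true with ≡ᵇ⇒≡ r ri (from T-≡ e₂)
...   | refl = mk⇔ (λ _ → to (agree r unpaired) ri≤fri) (λ _ → ≤-trans ri≤fri (<⇒≤ fri<frz))

swapLoop-agrees : ∀ Lx ps xs f → All (SoundPair Lx) ps → Agrees ps Lx f →
                  Agrees ps Lx (swapLoop ps xs f)
swapLoop-agrees Lx ps [] f sound agree = agree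
swapLoop-agrees Lx ps (ri ∷ xs) f sound agree with chooseZ f ri ps in e
... | nothing = swapLoop-agrees Lx ps xs f sound agree
... | just rz with chooseZ-sound Lx ps f ri sound e
...   | paired , ri≤fri , fri<frz =
  swapLoop-agrees Lx ps xs _ sound (swap-agrees agree paired ri≤fri fri<frz)

-- Final labels: paired rows get the partner label (sound, hence flagged on
-- both sides); unpaired rows keep the label computed by the swap loop.
finalLabel-agrees : ∀ Lx ps f → All (SoundPair Lx) ps → Agrees ps Lx f →
                    ∀ r → (r ≤ finalLabel ps f r ⇔ r ≤ Lx r)
finalLabel-agrees Lx ps f sound agree r with lookupPaired ps r in e
... | nothing = agree r e
... | just ly with All-lookup sound (lookupPaired-sound ps e)
...   | r≤ly , ly≤Lx = mk⇔ (λ _ → ≤-trans r≤ly ly≤Lx) (λ _ → r≤ly)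

ColumnFlagged : ℕ → Diagram → Labeling → Set
ColumnFlagged c T L = All (λ x → col x ≡ c → row x ≤ L x) T

newLabels-agrees : ∀ c T L → ColumnFlagged c T L →
                   ∀ r → (r ≤ newLabels c T L r ⇔ r ≤ L (suc c , r))
newLabels-agrees c T L columnFlagged =
  finalLabel-agrees Lx (proj₁ pairing) swapped sound
    (swapLoop-agrees Lx (proj₁ pairing) (proj₂ pairing) Lx sound (λ _ _ → ⇔-id _))
  where
  Lx : ℕ → ℕ
  Lx r = L (suc c , r)
  pairing : List (ℕ × ℕ) × List ℕ
  pairing = labelPair Lx (colRowsDesc (suc c) T) (colCells c T L)
  sound : All (SoundPair Lx) (proj₁ pairing)
  sound = labelPair-sound Lx (colRowsDesc (suc c) T) (colCells c T L)
            (colCells-all c T L columnFlagged)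
  swapped : ℕ → ℕ
  swapped = swapLoop (proj₁ pairing) (proj₂ pairing) Lx

newLabel : ℕ → Diagram → Labeling → Cell → ℕ
newLabel c T L x = if col x ≡ᵇ suc c then newLabels c T L (row x) else L x

newLabel-column : ∀ c T L x → col x ≡ c → newLabel c T L x ≡ L x
newLabel-column c T L (a , b) refl with a ≡ᵇ suc a in e
... | false = refl
... | true  = ⊥-elim (1+n≢n (sym (≡ᵇ⇒≡ a (suc a) (from T-≡ e))))

newLabel-agrees : ∀ c T L → ColumnFlagged c T L →
                  ∀ x → (row x ≤ newLabel c T L x ⇔ row x ≤ L x)
newLabel-agrees c T L columnFlagged (a , b) with a ≡ᵇ suc c in e
... | false = ⇔-id _
... | true with ≡ᵇ⇒≡ a (suc c) (from T-≡ e)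
...   | refl = newLabels-agrees c T L columnFlagged b

relabel-flagged : ∀ c T L → Flagged T L ⇔ FlaggedL (relabel c T L)
relabel-flagged c T L = mk⇔
  (λ flagged → from (relabeled (All-map (λ h _ → h) flagged)) flagged)
  (λ flagged′ → to (relabeled (columnOfRelabeled (map⁻ flagged′))) flagged′)
  where
  relabeled : ColumnFlagged c T L → FlaggedL (relabel c T L) ⇔ Flagged T L
  relabeled columnFlagged =
    All-map-⇔ (λ x → x , newLabel c T L x) (newLabel-agrees c T L columnFlagged) T
  columnOfRelabeled : All (λ x → row x ≤ newLabel c T L x) T → ColumnFlagged c T L
  columnOfRelabeled = All-map (λ {x} h e → subst (row x ≤_) (newLabel-column c T L x e) h)

lemma5p14 : (T : Diagram) → Unique T → All (λ x → 1 ≤ col x × 1 ≤ row x) T →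
            (L : Labeling) → All (λ x → 1 ≤ L x) T →
            (c : ℕ) → 1 ≤ c →
            Flagged T L ⇔ FlaggedL (RstarL c T L)
lemma5p14 T _ _ L _ c _ = ⇔-sym (Rstar-flagged c (relabel c T L)) ⇔-∘ relabel-flagged c T L
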